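{- Let $v_1\ge3$ and $v_2\ge1$ be integers, $\mathbf{v}=(v_1,v_2)$ and $\mathbf{k}=(3,1)$. If there exists a strong Kirkman signal set $\mathrm{SKSS}(v_1)$, then there exists a $2$-$(\mathbf{v},\mathbf{k},1)$ generalized packing with $\min\{D(v_1,3,2),\ v_2\lfloor v_1/3\rfloor\}$ blocks.
   Context: Let $X_1,X_2$ be disjoint sets with $|X_1|=v_1$, $|X_2|=v_2$. A block is a pair $(B,\{x\})$ with $B$ a $3$-subset of $X_1$ and $x\in X_2$. A $2$-$((v_1,v_2),(3,1),1)$ generalized packing is a family of blocks such that no $2$-subset of $X_1$ is contained in the first coordinate of more than one block, and for each $a\in X_1$, $x\in X_2$ at most one block $(B,\{x\})$ has $a\in B$. $D(v_1,3,2)$ is the maximum number of $3$-subsets of a $v_1$-set such that every $2$-subset lies in at most one of them (a maximum $2$-$(v_1,3,1)$ packing). A strong Kirkman signal set $\mathrm{SKSS}(v_1)$ is a maximum $2$-$(v_1,3,1)$ packing (with $D(v_1,3,2)$ blocks) whose blocks are partitioned into $s$ classes of size $m=\lfloor v_1/3\rfloor$ and one further class of size $r$, where $D(v_1,3,2)=sm+r$ and $0\le r<m$, such that within each class the blocks are pairwise disjoint. -}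

module Defs where

open import Data.Nat using (ℕ; _*_; _+_; _<_; _≤_; _⊓_; _/_)
open import Data.Fin using (Fin) renaming (_<_ to _<ᶠ_)
open import Data.Product using (Σ; _×_; _,_; proj₁; proj₂)
open import Data.Sum using (_⊎_; inj₁; inj₂)
open import Data.Empty using (⊥)
open import Relation.Binary.PropositionalEquality using (_≡_; _≢_)

-- A 3-subset of X = Fin v, represented canonically as a strictly increasing triple.
record Triple (v : ℕ) : Set where
  constructor triple
  field
    a b c : Fin v
    a<b : a <ᶠ b
    b<c : b <ᶠ c

open Triple public

_∈ₜ_ : {v : ℕ} → Fin v → Triple v → Set
x ∈ₜ t = x ≡ a t ⊎ x ≡ b t ⊎ x ≡ c t

DisjointT : {v : ℕ} → Triple v → Triple v → Set
DisjointT t u = ∀ x → x ∈ₜ t → x ∈ₜ u → ⊥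

IsPacking : {v : ℕ} {I : Set} → (I → Triple v) → Set
IsPacking {v} {I} B =
  ∀ (i j : I) → i ≢ j → ∀ (x y : Fin v) → x ≢ y →
  x ∈ₜ B i → y ∈ₜ B i → x ∈ₜ B j → y ∈ₜ B j → ⊥

-- d = D(v,3,2): a packing with d blocks exists, and every packing has ≤ d blocks.
IsPackingNumber : ℕ → ℕ → Set
IsPackingNumber v d =
  (Σ (Fin d → Triple v) IsPacking) ×
  (∀ (n : ℕ) (B : Fin n → Triple v) → IsPacking B → n ≤ d)

-- Strong Kirkman signal set SKSS(v), with m = ⌊v/3⌋:
-- a packing with D(v,3,2) = s*m + r blocks (0 ≤ r < m), blocks indexed by
-- (Fin s × Fin m) ⊎ Fin r, i.e. s classes of size m and one class of size r,
-- blocks within each class pairwise disjoint.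
SKSS : ℕ → Set
SKSS v =
  Σ ℕ λ s → Σ ℕ λ r →
  (r < v / 3) ×
  IsPackingNumber v (s * (v / 3) + r) ×
  Σ ((Fin s × Fin (v / 3)) ⊎ Fin r → Triple v) λ B →
    IsPacking B ×
    (∀ (k : Fin s) (i j : Fin (v / 3)) → i ≢ j →
       DisjointT (B (inj₁ (k , i))) (B (inj₁ (k , j)))) ×
    (∀ (i j : Fin r) → i ≢ j → DisjointT (B (inj₂ i)) (B (inj₂ j)))

-- 2-((v1,v2),(3,1),1) generalized packing: blocks (B,{x}), B ⊆ Fin v1 a 3-subset, x ∈ Fin v2.
IsGenPacking : {v₁ v₂ : ℕ} {I : Set} → (I → Triple v₁ × Fin v₂) → Set
IsGenPacking {v₁} {v₂} {I} G =
  (∀ (i j : I) → i ≢ j → ∀ (x y : Fin v₁) → x ≢ y →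
     x ∈ₜ proj₁ (G i) → y ∈ₜ proj₁ (G i) → x ∈ₜ proj₁ (G j) → y ∈ₜ proj₁ (G j) → ⊥) ×
  (∀ (i j : I) → i ≢ j → proj₂ (G i) ≡ proj₂ (G j) → ∀ (x : Fin v₁) →
     x ∈ₜ proj₁ (G i) → x ∈ₜ proj₁ (G j) → ⊥)

module Submission where

-- Let an SKSS(v₁) have s full classes of
-- m = ⌊v₁/3⌋ pairwise disjoint blocks and one class of r disjoint blocks.
-- List its D(v₁,3,2) = s·m + r blocks class by class and keep the first
-- N = min(d, v₂·m) of them, where d = D(v₁,3,2) is the given packing number
-- (so N ≤ d ≤ s·m + r by maximality of the SKSS count).  Attach to every kept
-- block its class number as the point of X₂; since N ≤ v₂·m, each kept block
-- lies in one of the first v₂ classes, so the label is a point of Fin v₂.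
-- The kept blocks still form a packing (condition 1), and two distinct kept
-- blocks with the same label come from the same class, hence are disjoint
-- (condition 2).

open import Defs
open import Data.Nat using (ℕ; _*_; _≤_; _⊓_; _/_; _+_; _<_)
open import Data.Nat.Properties
  using (≤-trans; m⊓n≤m; m⊓n≤n; *-comm; *-cancelˡ-<; *-cancelʳ-<; m≤m+n; <-≤-trans; ≤-<-trans; <-irrefl)
open import Data.Fin using (Fin; toℕ; fromℕ<; inject≤; splitAt; join; remQuot; combine)
open import Data.Fin.Properties
  using (toℕ-injective; toℕ<n; toℕ-inject≤; toℕ-combine; toℕ-↑ˡ; toℕ-↑ʳ; combine-remQuot;
         join-splitAt; fromℕ<-injective; inject≤-injective)
open import Data.Product using (Σ; _×_; _,_; uncurry)
open import Data.Sum using (_⊎_; inj₁; inj₂)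
import Data.Sum as Sum
open import Relation.Binary.PropositionalEquality using (_≡_; _≢_; refl; sym; trans; cong; subst)
open import Function.Definitions using (Injective)

module Enumeration (s m r : ℕ) where

  Index : Set
  Index = (Fin s × Fin m) ⊎ Fin r

  -- Class-by-class enumeration: position k·m + i is block i of class k,
  -- position s·m + j is block j of the last class.
  encode : Index → Fin (s * m + r)
  encode y = join (s * m) r (Sum.map₁ (uncurry combine) y)

  decode : Fin (s * m + r) → Index
  decode x = Sum.map₁ (remQuot m) (splitAt (s * m) x)

  encode-decode : ∀ x → encode (decode x) ≡ x
  encode-decode x with splitAt (s * m) x in eq
  ... | inj₁ z = trans (cong (λ w → join (s * m) r (inj₁ w)) (combine-remQuot {s} m z))
                   (trans (cong (join (s * m) r) (sym eq)) (join-splitAt (s * m) r x))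
  ... | inj₂ z = trans (cong (join (s * m) r) (sym eq)) (join-splitAt (s * m) r x)

  decode-injective : Injective _≡_ _≡_ decode
  decode-injective {x} {x'} e =
    trans (sym (encode-decode x)) (trans (cong encode e) (encode-decode x'))

  classOf : Index → ℕ
  classOf (inj₁ (k , _)) = toℕ k
  classOf (inj₂ _) = s

  classOf-bound : ∀ (n : ℕ) (y : Index) → toℕ (encode y) < n * m → classOf y < n
  classOf-bound n (inj₁ (k , i)) lt = *-cancelˡ-< m (toℕ k) n mk<mn
    where
    position : toℕ (encode (inj₁ (k , i))) ≡ m * toℕ k + toℕ i
    position = trans (toℕ-↑ˡ (combine k i) r) (toℕ-combine k i)
    mk<mn : m * toℕ k < m * n
    mk<mn = ≤-<-trans (m≤m+n (m * toℕ k) (toℕ i))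
              (subst (_< m * n) position (subst (toℕ (encode (inj₁ (k , i))) <_) (*-comm n m) lt))
  classOf-bound n (inj₂ j) lt = *-cancelʳ-< m s n
    (≤-<-trans (m≤m+n (s * m) (toℕ j)) (subst (_< n * m) (toℕ-↑ʳ (s * m) j) lt))

  sameClass-disjoint : {v : ℕ} (B : Index → Triple v) →
    (∀ (k : Fin s) (i j : Fin m) → i ≢ j → DisjointT (B (inj₁ (k , i))) (B (inj₁ (k , j)))) →
    (∀ (i j : Fin r) → i ≢ j → DisjointT (B (inj₂ i)) (B (inj₂ j))) →
    ∀ y y' → y ≢ y' → classOf y ≡ classOf y' → DisjointT (B y) (B y')
  sameClass-disjoint B full last (inj₁ (k , i)) (inj₁ (k' , i')) ne same with toℕ-injective same
  ... | refl = full k i i' (λ e → ne (cong (λ w → inj₁ (k , w)) e))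
  sameClass-disjoint B full last (inj₁ (k , i)) (inj₂ j) ne same = λ _ _ _ → <-irrefl same (toℕ<n k)
  sameClass-disjoint B full last (inj₂ j) (inj₁ (k , i)) ne same = λ _ _ _ → <-irrefl (sym same) (toℕ<n k)
  sameClass-disjoint B full last (inj₂ j) (inj₂ j') ne same = last j j' (λ e → ne (cong inj₂ e))

reindex-packing : {v : ℕ} {I J : Set} (B : I → Triple v) (f : J → I) →
  Injective _≡_ _≡_ f → IsPacking B → IsPacking (λ j → B (f j))
reindex-packing B f f-inj P i j ne = P (f i) (f j) (λ e → ne (f-inj e))

labelled-genPacking : {v₁ v₂ : ℕ} {I : Set} (B : I → Triple v₁) (label : I → Fin v₂) →
  IsPacking B →
  (∀ i j → i ≢ j → label i ≡ label j → DisjointT (B i) (B j)) →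
  IsGenPacking (λ i → B i , label i)
labelled-genPacking B label P sameLabel = P , sameLabel

theorem5p4 : (v₁ v₂ : ℕ) → 3 ≤ v₁ → 1 ≤ v₂ →
    (d : ℕ) → IsPackingNumber v₁ d →
    SKSS v₁ →
    Σ (Fin (d ⊓ (v₂ * (v₁ / 3))) → Triple v₁ × Fin v₂) IsGenPacking
theorem5p4 v₁ v₂ _ _ d ((Bd , Pd) , _) (s , r , _ , (_ , maximal) , B , P , full , last) =
  (λ n → B (pick n) , label n) , labelled-genPacking (λ n → B (pick n)) label
        (reindex-packing B pick pick-injective P)
        (λ i j ne e → sameClass-disjoint B full last (pick i) (pick j)
                        (λ p → ne (pick-injective p)) (fromℕ<-injective _ _ _ _ e))
  where
  open Enumeration s (v₁ / 3) r
  N = d ⊓ (v₂ * (v₁ / 3))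
  -- The packing Bd has d blocks, so the SKSS (a packing with s·m + r blocks) is long enough.
  N≤size : N ≤ s * (v₁ / 3) + r
  N≤size = ≤-trans (m⊓n≤m d _) (maximal d Bd Pd)
  pick : Fin N → Index
  pick n = decode (inject≤ n N≤size)
  pick-injective : Injective _≡_ _≡_ pick
  pick-injective e = inject≤-injective N≤size N≤size _ _ (decode-injective e)
  position : ∀ n → toℕ (encode (pick n)) ≡ toℕ n
  position n = trans (cong toℕ (encode-decode (inject≤ n N≤size))) (toℕ-inject≤ n N≤size)
  -- Since N ≤ v₂·m, every kept block lies in one of the first v₂ classes.
  label : Fin N → Fin v₂
  label n = fromℕ< (classOf-bound v₂ (pick n)
    (subst (_< v₂ * (v₁ / 3)) (sym (position n)) (<-≤-trans (toℕ<n n) (m⊓n≤n d _))))
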